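{- Fix $r\ge0$. Let $\mathscr C$ be a hereditary graph class that quantifier-free transduces the class of $r$-subdivisions of all graphs. Then $\mathscr C$ existentially transduces the class of all graphs.
   Context: Hereditary: closed under induced subgraphs. The $r$-subdivision of a graph replaces each edge by a path of length $r+1$. For a structure $\widehat G$ and formula $\varphi(x,y)$, $\varphi(\widehat G)$ is the graph on $V(\widehat G)$ with edges $uv$, $u\ne v$, such that $\widehat G\models\varphi(u,v)\lor\varphi(v,u)$. A class $\mathscr C$ transduces a class $\mathscr D$ if there is a class $\widehat{\mathscr C}$ of expansions of graphs of $\mathscr C$ by unary predicates and a formula $\varphi(x,y)$ in its signature such that every $H\in\mathscr D$ is an induced subgraph of $\varphi(\widehat G)$ for some $\widehat G\in\widehat{\mathscr C}$; it quantifier-free (resp. existentially) transduces $\mathscr D$ if $\varphi$ can be taken quantifier-free (resp. existential). -}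

module Defs where

open import Data.Nat.Base using (ℕ; zero; suc; _+_; _*_; _≡ᵇ_)
open import Data.Bool.Base using (Bool; true; false; not; _∧_; _∨_)
open import Data.Bool.Properties using (∨-comm)
open import Data.Fin.Base using (Fin; toℕ; splitAt; remQuot)
open import Data.Fin.Properties using (_≟_; _<?_)
open import Data.Vec.Functional using (_∷_; [])
open import Data.List.Base using (List; length; lookup; allFin; concatMap; map; filterᵇ)
open import Data.Product.Base using (Σ; _×_; _,_; proj₁; proj₂)
open import Data.Sum.Base using (_⊎_; inj₁; inj₂)
open import Data.Unit.Base using (⊤)
open import Relation.Nullary.Decidable.Core using (⌊_⌋; yes; no)
open import Relation.Binary.PropositionalEquality using (_≡_; refl; sym; cong)
open import Function.Definitions using (Injective; Bijective)

record Graph : Set where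
  field
    size    : ℕ
    adj     : Fin size → Fin size → Bool
    adj-sym : ∀ u v → adj u v ≡ adj v u
    adj-irr : ∀ u → adj u u ≡ false
open Graph public

GraphClass : Set₁
GraphClass = Graph → Set

InducedSub : Graph → Graph → Set
InducedSub H G = Σ (Fin (size H) → Fin (size G)) λ f →
  Injective _≡_ _≡_ f × (∀ u v → adj H u v ≡ adj G (f u) (f v))

Iso : Graph → Graph → Set
Iso H G = Σ (Fin (size H) → Fin (size G)) λ f →
  Bijective _≡_ _≡_ f × (∀ u v → adj H u v ≡ adj G (f u) (f v))

Hereditary : GraphClass → Set
Hereditary C = ∀ H G → C G → InducedSub H G → C H

AllGraphs : GraphClass
AllGraphs _ = ⊤

private
  ≟-sym : ∀ {n} (u v : Fin n) → ⌊ u ≟ v ⌋ ≡ ⌊ v ≟ u ⌋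
  ≟-sym u v with u ≟ v | v ≟ u
  ... | yes _ | yes _ = refl
  ... | no _  | no _  = refl
  ... | yes p | no q  with q (sym p)
  ... | ()
  ≟-sym u v | no p | yes q with p (sym q)
  ... | ()

  ≟-refl : ∀ {n} (u : Fin n) → ⌊ u ≟ u ⌋ ≡ true
  ≟-refl u with u ≟ u
  ... | yes _ = refl
  ... | no p with p refl
  ... | ()

symGraph : (n : ℕ) → (Fin n → Fin n → Bool) → Graph
symGraph n R = record
  { size = n
  ; adj = λ u v → not ⌊ u ≟ v ⌋ ∧ (R u v ∨ R v u)
  ; adj-sym = λ u v → pf u v
  ; adj-irr = λ u → irr u
  }
  where
  pf : ∀ u v → (not ⌊ u ≟ v ⌋ ∧ (R u v ∨ R v u)) ≡ (not ⌊ v ≟ u ⌋ ∧ (R v u ∨ R u v))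
  pf u v rewrite ≟-sym u v | ∨-comm (R u v) (R v u) = refl
  irr : ∀ u → (not ⌊ u ≟ u ⌋ ∧ (R u u ∨ R u u)) ≡ false
  irr u rewrite ≟-refl u = refl

-- First-order formulas over the signature {E} ∪ {P₀,…,P_{k-1}} (unary),
-- with equality, in de Bruijn style: Formula k v has free variables Fin v.

data Formula (k : ℕ) : ℕ → Set where
  ⊤'   : ∀ {v} → Formula k v
  ⊥'   : ∀ {v} → Formula k v
  eq'  : ∀ {v} → Fin v → Fin v → Formula k v
  E'   : ∀ {v} → Fin v → Fin v → Formula k v
  P'   : ∀ {v} → Fin k → Fin v → Formula k v
  ¬'_  : ∀ {v} → Formula k v → Formula k v
  _∧'_ : ∀ {v} → Formula k v → Formula k v → Formula k v
  _∨'_ : ∀ {v} → Formula k v → Formula k v → Formula k v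
  ∃'_  : ∀ {v} → Formula k (suc v) → Formula k v
  ∀'_  : ∀ {v} → Formula k (suc v) → Formula k v

data IsQF {k : ℕ} : ∀ {v} → Formula k v → Set where
  ⊤'   : ∀ {v} → IsQF {v = v} ⊤'
  ⊥'   : ∀ {v} → IsQF {v = v} ⊥'
  eq'  : ∀ {v} (x y : Fin v) → IsQF (eq' x y)
  E'   : ∀ {v} (x y : Fin v) → IsQF (E' x y)
  P'   : ∀ {v} (c : Fin k) (x : Fin v) → IsQF (P' c x)
  ¬'_  : ∀ {v} {φ : Formula k v} → IsQF φ → IsQF (¬' φ)
  _∧'_ : ∀ {v} {φ ψ : Formula k v} → IsQF φ → IsQF ψ → IsQF (φ ∧' ψ)
  _∨'_ : ∀ {v} {φ ψ : Formula k v} → IsQF φ → IsQF ψ → IsQF (φ ∨' ψ)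

data IsExistential {k : ℕ} : ∀ {v} → Formula k v → Set where
  qf : ∀ {v} {φ : Formula k v} → IsQF φ → IsExistential φ
  ex : ∀ {v} {φ : Formula k (suc v)} → IsExistential φ → IsExistential (∃' φ)

record ColoredGraph (k : ℕ) : Set where
  field
    graph : Graph
    col   : Fin k → Fin (size graph) → Bool
open ColoredGraph public

anyᵇ : ∀ {n} → (Fin n → Bool) → Bool
anyᵇ {zero}  f = false
anyᵇ {suc n} f = f Fin.zero ∨ anyᵇ (λ i → f (Fin.suc i))
  where import Data.Fin.Base as Fin

allᵇ : ∀ {n} → (Fin n → Bool) → Bool
allᵇ {zero}  f = true
allᵇ {suc n} f = f Fin.zero ∧ allᵇ (λ i → f (Fin.suc i))
  where import Data.Fin.Base as Fin

eval : ∀ {k v} (Ĝ : ColoredGraph k) → Formula k v →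
       (Fin v → Fin (size (graph Ĝ))) → Bool
eval Ĝ ⊤'         ρ = true
eval Ĝ ⊥'         ρ = false
eval Ĝ (eq' x y)  ρ = ⌊ ρ x ≟ ρ y ⌋
eval Ĝ (E' x y)   ρ = adj (graph Ĝ) (ρ x) (ρ y)
eval Ĝ (P' c x)   ρ = col Ĝ c (ρ x)
eval Ĝ (¬' φ)     ρ = not (eval Ĝ φ ρ)
eval Ĝ (φ ∧' ψ)   ρ = eval Ĝ φ ρ ∧ eval Ĝ ψ ρ
eval Ĝ (φ ∨' ψ)   ρ = eval Ĝ φ ρ ∨ eval Ĝ ψ ρ
eval Ĝ (∃' φ)     ρ = anyᵇ (λ a → eval Ĝ φ (a ∷ ρ))
eval Ĝ (∀' φ)     ρ = allᵇ (λ a → eval Ĝ φ (a ∷ ρ))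

interpret : ∀ {k} → Formula k 2 → ColoredGraph k → Graph
interpret φ Ĝ = symGraph (size (graph Ĝ)) (λ u v → eval Ĝ φ (u ∷ v ∷ []))

Transduces : (∀ {k} → Formula k 2 → Set) → GraphClass → GraphClass → Set₁
Transduces Frag C D =
  Σ ℕ λ k → Σ (Formula k 2) λ φ → Frag φ ×
  Σ (ColoredGraph k → Set) λ Ĉ →
    (∀ Ĝ → Ĉ Ĝ → C (graph Ĝ)) ×
    (∀ H → D H → Σ (ColoredGraph k) λ Ĝ → Ĉ Ĝ × InducedSub H (interpret φ Ĝ))

QFTransduces : GraphClass → GraphClass → Set₁
QFTransduces = Transduces IsQF

ExTransduces : GraphClass → GraphClass → Set₁
ExTransduces = Transduces IsExistential

edgeList : (G : Graph) → List (Fin (size G) × Fin (size G))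
edgeList G = filterᵇ (λ p → ⌊ proj₁ p <? proj₂ p ⌋ ∧ adj G (proj₁ p) (proj₂ p))
  (concatMap (λ i → map (λ j → (i , j)) (allFin (size G))) (allFin (size G)))

-- vertices: Fin n ⊎ (edge e × position t < r); the edge e = {a,b}
-- (a < b) becomes the path a — (e,0) — (e,1) — … — (e,r-1) — b
-- (for r = 0 the edge ab is kept).
subdivision : ℕ → Graph → Graph
subdivision r G = symGraph (size G + m * r) (λ u v → R (decode u) (decode v))
  where
  es = edgeList G
  m = length es
  ends = lookup es
  decode : Fin (size G + m * r) → Fin (size G) ⊎ (Fin m × Fin r)
  decode u with splitAt (size G) u
  ... | inj₁ x = inj₁ x
  ... | inj₂ y = inj₂ (remQuot r y)
  R : Fin (size G) ⊎ (Fin m × Fin r) → Fin (size G) ⊎ (Fin m × Fin r) → Bool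
  R (inj₁ x) (inj₁ y) = (r ≡ᵇ 0) ∧ adj G x y
  R (inj₁ x) (inj₂ (e , t)) =
    (⌊ x ≟ proj₁ (ends e) ⌋ ∧ (toℕ t ≡ᵇ 0)) ∨
    (⌊ x ≟ proj₂ (ends e) ⌋ ∧ (suc (toℕ t) ≡ᵇ r))
  R (inj₂ _) (inj₁ _) = false
  R (inj₂ (e , t)) (inj₂ (e' , t')) = ⌊ e ≟ e' ⌋ ∧ (suc (toℕ t) ≡ᵇ toℕ t')

Subdivisions : ℕ → GraphClass
Subdivisions r H = Σ Graph λ G → Iso H (subdivision r G)

-- Mark the images of the subdivision vertices by a new unary predicate. Inside an induced
-- copy of the subdivision, a marked vertex on the path of an edge xy is only adjacent to
-- marked vertices of the same path and to x and y, so two branch vertices are adjacent in H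
-- exactly when φ(Ĝ) joins them by a walk of length r + 1 through marked vertices. Guessing
-- the r inner vertices of such a walk is expressed by an existential formula.

module Submission where

open import Defs
open import Data.Bool.Base using (Bool; true; false; not; _∧_; _∨_; T)
open import Data.Bool.Properties using (T-∧; T-∨; ∧-assoc)
open import Data.Empty using (⊥-elim)
open import Data.Fin.Base as Fin using (Fin; toℕ; splitAt; remQuot; combine; _↑ˡ_; _↑ʳ_; fromℕ<)
open import Data.Fin.Properties
  using (_≟_; _<?_; <-cmp; splitAt-↑ˡ; splitAt-↑ʳ; remQuot-combine; ↑ˡ-injective; toℕ-fromℕ<)
open import Data.List.Base using (List; length; lookup; allFin; concatMap; map)
open import Data.List.Membership.Propositional using (_∈_)
open import Data.List.Membership.Propositional.Properties
  using (∈-lookup; ∈-filter⁻; ∈-filter⁺; ∈-concatMap⁺; ∈-map⁺; ∈-allFin)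
import Data.List.Relation.Unary.Any as Any
open import Data.List.Relation.Unary.Any.Properties using (lookup-index)
open import Data.Nat.Base using (ℕ; zero; suc; _+_; _*_; _≡ᵇ_; _<_; s≤s)
open import Data.Nat.Properties using (≡⇒≡ᵇ; 1+n≢n; +-suc; +-identityʳ; m≤n+m)
open import Data.Product.Base as Product using (Σ; ∃; ∃₂; _×_; _,_; proj₁; proj₂)
open import Data.Product.Properties using (,-injectiveʳ)
open import Data.Sum.Base using (_⊎_; inj₁; inj₂)
open import Data.Sum.Properties using (inj₂-injective)
open import Data.Unit.Base using (tt)
open import Data.Vec.Functional using (_∷_; [])
open import Function.Base using (id; _∘_)
open import Function.Bundles using (Equivalence)
open import Function.Construct.Identity using (bijective)
open import Function.Definitions using (Injective)
open import Relation.Binary.Definitions using (tri<; tri≈; tri>)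
open import Relation.Binary.PropositionalEquality
  using (_≡_; _≢_; refl; sym; trans; cong; cong₂; subst; subst₂; module ≡-Reasoning)
open import Relation.Nullary.Decidable using (⌊_⌋; yes; no; T?; toWitness; fromWitness; fromWitnessFalse)

open Equivalence using (to; from)

T-injective : ∀ {a b} → (T a → T b) → (T b → T a) → a ≡ b
T-injective {false} {false} _ _ = refl
T-injective {false} {true}  _ g = ⊥-elim (g tt)
T-injective {true}  {false} f _ = ⊥-elim (f tt)
T-injective {true}  {true}  _ _ = refl

anyᵇ-intro : ∀ {n} (f : Fin n → Bool) a → T (f a) → T (anyᵇ f)
anyᵇ-intro f Fin.zero    p = from T-∨ (inj₁ p)
anyᵇ-intro f (Fin.suc a) p = from T-∨ (inj₂ (anyᵇ-intro (f ∘ Fin.suc) a p))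

anyᵇ-elim : ∀ {n} (f : Fin n → Bool) → T (anyᵇ f) → ∃ λ a → T (f a)
anyᵇ-elim {suc n} f p with to T-∨ p
... | inj₁ q = Fin.zero , q
... | inj₂ q = Product.map Fin.suc id (anyᵇ-elim (f ∘ Fin.suc) q)

anyᵇ-cong : ∀ {n} {f g : Fin n → Bool} → (∀ a → f a ≡ g a) → anyᵇ f ≡ anyᵇ g
anyᵇ-cong {zero}  h = refl
anyᵇ-cong {suc n} h = cong₂ _∨_ (h Fin.zero) (anyᵇ-cong (h ∘ Fin.suc))

allᵇ-cong : ∀ {n} {f g : Fin n → Bool} → (∀ a → f a ≡ g a) → allᵇ f ≡ allᵇ g
allᵇ-cong {zero}  h = refl
allᵇ-cong {suc n} h = cong₂ _∧_ (h Fin.zero) (allᵇ-cong (h ∘ Fin.suc))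

anyᵇ-false : ∀ n → anyᵇ {n} (λ _ → false) ≡ false
anyᵇ-false zero    = refl
anyᵇ-false (suc n) = anyᵇ-false n

anyᵇ-∧ : ∀ {n} b (f : Fin n → Bool) → anyᵇ (λ a → b ∧ f a) ≡ b ∧ anyᵇ f
anyᵇ-∧     true  f = refl
anyᵇ-∧ {n} false f = anyᵇ-false n

rename : ∀ {k k' v w} → (Fin k → Fin k') → (Fin v → Fin w) → Formula k v → Formula k' w
rename τ σ ⊤'        = ⊤'
rename τ σ ⊥'        = ⊥'
rename τ σ (eq' x y) = eq' (σ x) (σ y)
rename τ σ (E' x y)  = E' (σ x) (σ y)
rename τ σ (P' c x)  = P' (τ c) (σ x)
rename τ σ (¬' φ)    = ¬' rename τ σ φ
rename τ σ (φ ∧' ψ)  = rename τ σ φ ∧' rename τ σ ψ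
rename τ σ (φ ∨' ψ)  = rename τ σ φ ∨' rename τ σ ψ
rename τ σ (∃' φ)    = ∃' rename τ (Fin.lift 1 σ) φ
rename τ σ (∀' φ)    = ∀' rename τ (Fin.lift 1 σ) φ

rename-QF : ∀ {k k' v w} (τ : Fin k → Fin k') (σ : Fin v → Fin w) {φ : Formula k v} →
  IsQF φ → IsQF (rename τ σ φ)
rename-QF τ σ ⊤'        = ⊤'
rename-QF τ σ ⊥'        = ⊥'
rename-QF τ σ (eq' x y) = eq' (σ x) (σ y)
rename-QF τ σ (E' x y)  = E' (σ x) (σ y)
rename-QF τ σ (P' c x)  = P' (τ c) (σ x)
rename-QF τ σ (¬' q)    = ¬' rename-QF τ σ q
rename-QF τ σ (q ∧' q') = rename-QF τ σ q ∧' rename-QF τ σ q'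
rename-QF τ σ (q ∨' q') = rename-QF τ σ q ∨' rename-QF τ σ q'

recolour : ∀ {k k'} → ColoredGraph k' → (Fin k → Fin k') → ColoredGraph k
recolour Ĝ τ = record { graph = graph Ĝ ; col = col Ĝ ∘ τ }

lift-agrees : ∀ {v w} {A : Set} {σ : Fin v → Fin w} {ρ : Fin w → A} {ρ' : Fin v → A} →
  (∀ i → ρ (σ i) ≡ ρ' i) → ∀ a i → (a ∷ ρ) (Fin.lift 1 σ i) ≡ (a ∷ ρ') i
lift-agrees h a Fin.zero    = refl
lift-agrees h a (Fin.suc i) = h i

eval-rename : ∀ {k k' v w} (Ĝ : ColoredGraph k') (τ : Fin k → Fin k') (σ : Fin v → Fin w)
  (φ : Formula k v) {ρ : Fin w → Fin (size (graph Ĝ))} {ρ' : Fin v → Fin (size (graph Ĝ))} →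
  (∀ i → ρ (σ i) ≡ ρ' i) → eval Ĝ (rename τ σ φ) ρ ≡ eval (recolour Ĝ τ) φ ρ'
eval-rename Ĝ τ σ ⊤'        h = refl
eval-rename Ĝ τ σ ⊥'        h = refl
eval-rename Ĝ τ σ (eq' x y) h = cong₂ (λ a b → ⌊ a ≟ b ⌋) (h x) (h y)
eval-rename Ĝ τ σ (E' x y)  h = cong₂ (adj (graph Ĝ)) (h x) (h y)
eval-rename Ĝ τ σ (P' c x)  h = cong (col Ĝ (τ c)) (h x)
eval-rename Ĝ τ σ (¬' φ)    h = cong not (eval-rename Ĝ τ σ φ h)
eval-rename Ĝ τ σ (φ ∧' ψ)  h = cong₂ _∧_ (eval-rename Ĝ τ σ φ h) (eval-rename Ĝ τ σ ψ h)
eval-rename Ĝ τ σ (φ ∨' ψ)  h = cong₂ _∨_ (eval-rename Ĝ τ σ φ h) (eval-rename Ĝ τ σ ψ h)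
eval-rename Ĝ τ σ (∃' φ)    h = anyᵇ-cong λ a → eval-rename Ĝ τ (Fin.lift 1 σ) φ (lift-agrees h a)
eval-rename Ĝ τ σ (∀' φ)    h = allᵇ-cong λ a → eval-rename Ĝ τ (Fin.lift 1 σ) φ (lift-agrees h a)

-- Walks through marked vertices

addColour : ∀ {k} (Ĝ : ColoredGraph k) → (Fin (size (graph Ĝ)) → Bool) → ColoredGraph (suc k)
addColour Ĝ mark = record { graph = graph Ĝ ; col = mark ∷ col Ĝ }

markedWalk : (G : Graph) → (Fin (size G) → Bool) → ℕ → Fin (size G) → Fin (size G) → Bool
markedWalk G mark zero    a b = adj G a b
markedWalk G mark (suc c) a b = anyᵇ λ z → (mark z ∧ adj G a z) ∧ markedWalk G mark c z b

module _ (G : Graph) (mark : Fin (size G) → Bool) (c : ℕ) (a b : Fin (size G)) where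

  markedWalk-suc⁻ : T (markedWalk G mark (suc c) a b) →
    ∃ λ z → T (mark z) × T (adj G a z) × T (markedWalk G mark c z b)
  markedWalk-suc⁻ p with anyᵇ-elim _ p
  ... | z , q with to T-∧ q
  ... | q′ , zb with to T-∧ q′
  ... | z-marked , az = z , z-marked , az , zb

  markedWalk-suc⁺ : ∀ z → T (mark z) → T (adj G a z) → T (markedWalk G mark c z b) →
    T (markedWalk G mark (suc c) a b)
  markedWalk-suc⁺ z z-marked az zb =
    anyᵇ-intro _ z (from T-∧ (from T-∧ (z-marked , az) , zb))

image : ∀ {m n} → (Fin m → Fin n) → (Fin m → Bool) → Fin n → Bool
image f mark z = anyᵇ λ w → ⌊ f w ≟ z ⌋ ∧ mark w

module _ {m n} (f : Fin m → Fin n) (mark : Fin m → Bool) where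

  image⁺ : ∀ w → T (mark w) → T (image f mark (f w))
  image⁺ w w-marked = anyᵇ-intro _ w (from T-∧ (fromWitness refl , w-marked))

  image⁻ : ∀ z → T (image f mark z) → ∃ λ w → f w ≡ z × T (mark w)
  image⁻ z p with anyᵇ-elim _ p
  ... | w , q with to T-∧ q
  ... | fw≡z , w-marked = w , toWitness fw≡z , w-marked

markedWalk-image : (S G : Graph) (f : Fin (size S) → Fin (size G)) →
  (∀ u v → adj S u v ≡ adj G (f u) (f v)) → (mark : Fin (size S) → Bool) →
  ∀ c a b → markedWalk G (image f mark) c (f a) (f b) ≡ markedWalk S mark c a b
markedWalk-image S G f f-adj mark zero    a b = sym (f-adj a b)
markedWalk-image S G f f-adj mark (suc c) a b = T-injective reflect preserve
  where
  IH : ∀ z → markedWalk G (image f mark) c (f z) (f b) ≡ markedWalk S mark c z b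
  IH z = markedWalk-image S G f f-adj mark c z b

  reflect : T (markedWalk G (image f mark) (suc c) (f a) (f b)) → T (markedWalk S mark (suc c) a b)
  reflect p with markedWalk-suc⁻ G (image f mark) c (f a) (f b) p
  ... | z , z-marked , az , zb with image⁻ f mark z z-marked
  ... | w , refl , w-marked =
    markedWalk-suc⁺ S mark c a b w w-marked (subst T (sym (f-adj a w)) az) (subst T (IH w) zb)

  preserve : T (markedWalk S mark (suc c) a b) → T (markedWalk G (image f mark) (suc c) (f a) (f b))
  preserve p with markedWalk-suc⁻ S mark c a b p
  ... | w , w-marked , aw , wb =
    markedWalk-suc⁺ G (image f mark) c (f a) (f b) (f w) (image⁺ f mark w w-marked) (subst T (f-adj a w) aw)
      (subst T (sym (IH w)) wb)

-- The existential formula; colour 0 is the mark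

module _ {k : ℕ} (φ : Formula k 2) where

  adjacentFormula : ∀ {v} → Fin v → Fin v → Formula (suc k) v
  adjacentFormula p q =
    (¬' eq' p q) ∧' (rename Fin.suc (p ∷ q ∷ []) φ ∨' rename Fin.suc (q ∷ p ∷ []) φ)

  stepGuard : ∀ {v} → Formula (suc k) v → Fin v → Formula (suc k) (suc v)
  stepGuard acc p = rename id Fin.suc acc ∧' (P' Fin.zero Fin.zero ∧' adjacentFormula (Fin.suc p) Fin.zero)

  -- The guard acc is pushed below each new quantifier, keeping the formula in prenex form.
  walkFormula : ∀ {v} → Formula (suc k) v → ℕ → Fin v → Fin v → Formula (suc k) v
  walkFormula acc zero    p q = acc ∧' adjacentFormula p q
  walkFormula acc (suc c) p q = ∃' walkFormula (stepGuard acc p) c Fin.zero (Fin.suc q)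

  markedWalkFormula : ℕ → Formula (suc k) 2
  markedWalkFormula r = walkFormula ⊤' r Fin.zero (Fin.suc Fin.zero)

  module _ (φ-qf : IsQF φ) where

    adjacentFormula-QF : ∀ {v} (p q : Fin v) → IsQF (adjacentFormula p q)
    adjacentFormula-QF p q =
      (¬' eq' p q) ∧' (rename-QF Fin.suc (p ∷ q ∷ []) φ-qf ∨' rename-QF Fin.suc (q ∷ p ∷ []) φ-qf)

    stepGuard-QF : ∀ {v} {acc : Formula (suc k) v} → IsQF acc → ∀ p → IsQF (stepGuard acc p)
    stepGuard-QF acc-qf p =
      rename-QF id Fin.suc acc-qf ∧' (P' Fin.zero Fin.zero ∧' adjacentFormula-QF (Fin.suc p) Fin.zero)

    walkFormula-existential : ∀ {v} {acc : Formula (suc k) v} → IsQF acc →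
      ∀ c p q → IsExistential (walkFormula acc c p q)
    walkFormula-existential acc-qf zero    p q = qf (acc-qf ∧' adjacentFormula-QF p q)
    walkFormula-existential acc-qf (suc c) p q =
      ex (walkFormula-existential (stepGuard-QF acc-qf p) c Fin.zero (Fin.suc q))

    markedWalkFormula-existential : ∀ r → IsExistential (markedWalkFormula r)
    markedWalkFormula-existential r = walkFormula-existential ⊤' r Fin.zero (Fin.suc Fin.zero)

  module _ (Ĝ : ColoredGraph k) (mark : Fin (size (graph Ĝ)) → Bool) where

    private
      Ĝ⁺ : ColoredGraph (suc k)
      Ĝ⁺ = addColour Ĝ mark

      pair-agrees : ∀ {v} (ρ : Fin v → Fin (size (graph Ĝ))) p q i →
        ρ ((p ∷ q ∷ []) i) ≡ (ρ p ∷ ρ q ∷ []) i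
      pair-agrees ρ p q Fin.zero           = refl
      pair-agrees ρ p q (Fin.suc Fin.zero) = refl

    eval-adjacentFormula : ∀ {v} (p q : Fin v) ρ →
      eval Ĝ⁺ (adjacentFormula p q) ρ ≡ adj (interpret φ Ĝ) (ρ p) (ρ q)
    eval-adjacentFormula p q ρ = cong₂ (λ s t → not ⌊ ρ p ≟ ρ q ⌋ ∧ (s ∨ t))
      (eval-rename Ĝ⁺ Fin.suc (p ∷ q ∷ []) φ (pair-agrees ρ p q))
      (eval-rename Ĝ⁺ Fin.suc (q ∷ p ∷ []) φ (pair-agrees ρ q p))

    eval-walkFormula : ∀ c {v} (acc : Formula (suc k) v) p q ρ →
      eval Ĝ⁺ (walkFormula acc c p q) ρ ≡ eval Ĝ⁺ acc ρ ∧ markedWalk (interpret φ Ĝ) mark c (ρ p) (ρ q)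
    eval-walkFormula zero    acc p q ρ = cong (eval Ĝ⁺ acc ρ ∧_) (eval-adjacentFormula p q ρ)
    eval-walkFormula (suc c) acc p q ρ = begin
      anyᵇ (λ z → eval Ĝ⁺ (walkFormula (stepGuard acc p) c Fin.zero (Fin.suc q)) (z ∷ ρ))
        ≡⟨ anyᵇ-cong (λ z → eval-walkFormula c (stepGuard acc p) Fin.zero (Fin.suc q) (z ∷ ρ)) ⟩
      anyᵇ (λ z → eval Ĝ⁺ (stepGuard acc p) (z ∷ ρ) ∧ W z)
        ≡⟨ anyᵇ-cong (λ z → cong (_∧ W z) (cong₂ (λ s t → s ∧ (mark z ∧ t))
             (eval-rename Ĝ⁺ id Fin.suc acc (λ _ → refl))
             (eval-adjacentFormula (Fin.suc p) Fin.zero (z ∷ ρ)))) ⟩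
      anyᵇ (λ z → (eval Ĝ⁺ acc ρ ∧ step z) ∧ W z)
        ≡⟨ anyᵇ-cong (λ z → ∧-assoc (eval Ĝ⁺ acc ρ) (step z) (W z)) ⟩
      anyᵇ (λ z → eval Ĝ⁺ acc ρ ∧ (step z ∧ W z))
        ≡⟨ anyᵇ-∧ (eval Ĝ⁺ acc ρ) (λ z → step z ∧ W z) ⟩
      eval Ĝ⁺ acc ρ ∧ markedWalk (interpret φ Ĝ) mark (suc c) (ρ p) (ρ q) ∎
      where
      open ≡-Reasoning
      step : Fin (size (graph Ĝ)) → Bool
      step z = mark z ∧ adj (interpret φ Ĝ) (ρ p) z
      W : Fin (size (graph Ĝ)) → Bool
      W z = markedWalk (interpret φ Ĝ) mark c z (ρ q)

    eval-markedWalkFormula : ∀ r a b →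
      eval Ĝ⁺ (markedWalkFormula r) (a ∷ b ∷ []) ≡ markedWalk (interpret φ Ĝ) mark r a b
    eval-markedWalkFormula r a b = eval-walkFormula r ⊤' Fin.zero (Fin.suc Fin.zero) (a ∷ b ∷ [])

-- The structure of a subdivision

module Subdivided (G : Graph) (r : ℕ) where

  S : Graph
  S = subdivision r G

  n m N : ℕ
  n = size G
  m = length (edgeList G)
  N = n + m * r

  ends : Fin m → Fin n × Fin n
  ends = lookup (edgeList G)

  Point : Set
  Point = Fin n ⊎ (Fin m × Fin r)

  -- decode and link reproduce the definitions local to subdivision, so that
  -- adj-subdivision holds by computation.
  decodeSplit : Fin n ⊎ Fin (m * r) → Point
  decodeSplit (inj₁ x) = inj₁ x
  decodeSplit (inj₂ y) = inj₂ (remQuot r y)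

  decode : Fin N → Point
  decode u = decodeSplit (splitAt n u)

  link : Point → Point → Bool
  link (inj₁ x) (inj₁ y) = (r ≡ᵇ 0) ∧ adj G x y
  link (inj₁ x) (inj₂ (e , t)) =
    (⌊ x ≟ proj₁ (ends e) ⌋ ∧ (toℕ t ≡ᵇ 0)) ∨
    (⌊ x ≟ proj₂ (ends e) ⌋ ∧ (suc (toℕ t) ≡ᵇ r))
  link (inj₂ _) (inj₁ _) = false
  link (inj₂ (e , t)) (inj₂ (e' , t')) = ⌊ e ≟ e' ⌋ ∧ (suc (toℕ t) ≡ᵇ toℕ t')

  adj-subdivision : ∀ u v →
    adj S u v ≡ not ⌊ u ≟ v ⌋ ∧ (link (decode u) (decode v) ∨ link (decode v) (decode u))
  adj-subdivision u v with splitAt n u | splitAt n v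
  ... | inj₁ _ | inj₁ _ = refl
  ... | inj₁ _ | inj₂ _ = refl
  ... | inj₂ _ | inj₁ _ = refl
  ... | inj₂ _ | inj₂ _ = refl

  branch : Fin n → Fin N
  branch x = x ↑ˡ (m * r)

  inner : Fin m → Fin r → Fin N
  inner e t = n ↑ʳ combine e t

  decode-branch : ∀ x → decode (branch x) ≡ inj₁ x
  decode-branch x rewrite splitAt-↑ˡ n x (m * r) = refl

  decode-inner : ∀ e t → decode (inner e t) ≡ inj₂ (e , t)
  decode-inner e t rewrite splitAt-↑ʳ n (m * r) (combine e t) | remQuot-combine {m} {r} e t = refl

  branch-injective : Injective _≡_ _≡_ branch
  branch-injective {x} {y} = ↑ˡ-injective (m * r) x y

  branch≢inner : ∀ x e t → branch x ≢ inner e t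
  branch≢inner x e t eq with trans (sym (decode-branch x)) (trans (cong decode eq) (decode-inner e t))
  ... | ()

  inner-injectiveʳ : ∀ {e e' t t'} → inner e t ≡ inner e' t' → t ≡ t'
  inner-injectiveʳ {e} {e'} {t} {t'} eq =
    ,-injectiveʳ (inj₂-injective (trans (sym (decode-inner e t)) (trans (cong decode eq) (decode-inner e' t'))))

  isInnerPoint : Point → Bool
  isInnerPoint (inj₁ _) = false
  isInnerPoint (inj₂ _) = true

  isInnerPoint⁻ : ∀ p → T (isInnerPoint p) → ∃₂ λ e t → p ≡ inj₂ (e , t)
  isInnerPoint⁻ (inj₂ (e , t)) _ = e , t , refl

  isInner : Fin N → Bool
  isInner = isInnerPoint ∘ decode

  isInner-inner : ∀ e t → T (isInner (inner e t))
  isInner-inner e t rewrite decode-inner e t = tt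

  adjacent⇒linked : ∀ a b {p q} → decode a ≡ p → decode b ≡ q → T (adj S a b) →
    T (link p q) ⊎ T (link q p)
  adjacent⇒linked a b refl refl h =
    to (T-∨ {link (decode a) (decode b)}) (proj₂ (to (T-∧ {not ⌊ a ≟ b ⌋}) (subst T (adj-subdivision a b) h)))

  linked⇒adjacent : ∀ a b {p q} → a ≢ b → decode a ≡ p → decode b ≡ q → T (link p q) ⊎ T (link q p) →
    T (adj S a b)
  linked⇒adjacent a b a≢b refl refl l = subst T (sym (adj-subdivision a b))
    (from (T-∧ {not ⌊ a ≟ b ⌋}) (fromWitnessFalse a≢b , from (T-∨ {link (decode a) (decode b)}) l))

  Endpoint : Fin m → Fin n → Set
  Endpoint e x = x ≡ proj₁ (ends e) ⊎ x ≡ proj₂ (ends e)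

  link-branch-inner : ∀ x e t → T (link (inj₁ x) (inj₂ (e , t))) → Endpoint e x
  link-branch-inner x e t l with x ≟ proj₁ (ends e) | x ≟ proj₂ (ends e)
  ... | yes x≡end₁ | _         = inj₁ x≡end₁
  ... | no _       | yes x≡end₂ = inj₂ x≡end₂
  ... | no _       | no _       = ⊥-elim l

  link-inner-inner : ∀ e t e' t' → T (link (inj₂ (e , t)) (inj₂ (e' , t'))) → e ≡ e'
  link-inner-inner e t e' t' l with e ≟ e'
  ... | yes e≡e' = e≡e'
  ... | no _     = ⊥-elim l

  link-first : ∀ e (t : Fin r) → toℕ t ≡ 0 → T (link (inj₁ (proj₁ (ends e))) (inj₂ (e , t)))
  link-first e t t≡0 with proj₁ (ends e) ≟ proj₁ (ends e)
  ... | yes _ rewrite t≡0 = tt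
  ... | no ≢refl = ⊥-elim (≢refl refl)

  link-last : ∀ e (t : Fin r) → suc (toℕ t) ≡ r → T (link (inj₁ (proj₂ (ends e))) (inj₂ (e , t)))
  link-last e t last with proj₂ (ends e) ≟ proj₂ (ends e)
  ... | no ≢refl = ⊥-elim (≢refl refl)
  ... | yes _ with proj₂ (ends e) ≟ proj₁ (ends e)
  ...   | yes _ = from (T-∨ {toℕ t ≡ᵇ 0}) (inj₂ (≡⇒≡ᵇ _ _ last))
  ...   | no _  = ≡⇒≡ᵇ _ _ last

  link-next : ∀ e (t t' : Fin r) → toℕ t' ≡ suc (toℕ t) → T (link (inj₂ (e , t)) (inj₂ (e , t')))
  link-next e t t' next with e ≟ e
  ... | yes _ = ≡⇒≡ᵇ _ _ (sym next)
  ... | no ≢refl = ⊥-elim (≢refl refl)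

  branch-adjacent-branch : ∀ x y → T (adj S (branch x) (branch y)) → T (adj G x y)
  branch-adjacent-branch x y h
    with adjacent⇒linked (branch x) (branch y) (decode-branch x) (decode-branch y) h
  ... | inj₁ l = proj₂ (to (T-∧ {r ≡ᵇ 0}) l)
  ... | inj₂ l = subst T (adj-sym G y x) (proj₂ (to (T-∧ {r ≡ᵇ 0}) l))

  branch-adjacent-inner : ∀ x w {e t} → decode w ≡ inj₂ (e , t) → T (adj S (branch x) w) → Endpoint e x
  branch-adjacent-inner x w {e} {t} dw h with adjacent⇒linked (branch x) w (decode-branch x) dw h
  ... | inj₁ l = link-branch-inner x e t l

  inner-adjacent-inner : ∀ w w' {e e' t t'} → decode w ≡ inj₂ (e , t) → decode w' ≡ inj₂ (e' , t') →
    T (adj S w w') → e ≡ e'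
  inner-adjacent-inner w w' {e} {e'} {t} {t'} dw dw' h with adjacent⇒linked w w' dw dw' h
  ... | inj₁ l = link-inner-inner e t e' t' l
  ... | inj₂ l = sym (link-inner-inner e' t' e t l)

  -- edgeList G is the filter of candidatePairs by isEdge.
  candidatePairs : List (Fin n × Fin n)
  candidatePairs = concatMap (λ i → map (λ j → (i , j)) (allFin n)) (allFin n)

  isEdge : Fin n × Fin n → Bool
  isEdge p = ⌊ proj₁ p <? proj₂ p ⌋ ∧ adj G (proj₁ p) (proj₂ p)

  ends-adjacent : ∀ e → T (adj G (proj₁ (ends e)) (proj₂ (ends e)))
  ends-adjacent e = proj₂ (to (T-∧ {⌊ proj₁ (ends e) <? proj₂ (ends e) ⌋})
    (proj₂ (∈-filter⁻ (T? ∘ isEdge) {xs = candidatePairs} (∈-lookup e))))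

  ends-distinct : ∀ e → proj₁ (ends e) ≢ proj₂ (ends e)
  ends-distinct e eq with subst (λ y → T (adj G (proj₁ (ends e)) y)) (sym eq) (ends-adjacent e)
  ... | loop rewrite adj-irr G (proj₁ (ends e)) = loop

  endpoints-adjacent : ∀ e {x y} → Endpoint e x → Endpoint e y → x ≢ y → T (adj G x y)
  endpoints-adjacent e (inj₁ refl) (inj₂ refl) _   = ends-adjacent e
  endpoints-adjacent e (inj₂ refl) (inj₁ refl) _   = subst T (adj-sym G _ _) (ends-adjacent e)
  endpoints-adjacent e (inj₁ refl) (inj₁ refl) x≢y = ⊥-elim (x≢y refl)
  endpoints-adjacent e (inj₂ refl) (inj₂ refl) x≢y = ⊥-elim (x≢y refl)

  edge-index : ∀ {x y} → x Fin.< y → T (adj G x y) → ∃ λ e → ends e ≡ (x , y)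
  edge-index {x} {y} x<y xy = Any.index edge , sym (lookup-index edge)
    where
    edge : (x , y) ∈ edgeList G
    edge = ∈-filter⁺ _ (∈-concatMap⁺ _ (Any.map (λ { refl → ∈-map⁺ _ (∈-allFin y) }) (∈-allFin x)))
                       (from T-∧ (fromWitness x<y , xy))

  walk : ℕ → Fin N → Fin N → Bool
  walk = markedWalk S isInner

  walk-fromInner-endpoint : ∀ c w {e t} y → decode w ≡ inj₂ (e , t) → T (walk c w (branch y)) →
    Endpoint e y
  walk-fromInner-endpoint zero w y dw p =
    branch-adjacent-inner y w dw (subst T (adj-sym S w (branch y)) p)
  walk-fromInner-endpoint (suc c) w y dw p with markedWalk-suc⁻ S isInner c w (branch y) p
  ... | z , z-inner , wz , zy with isInnerPoint⁻ (decode z) z-inner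
  ... | _ , _ , dz with inner-adjacent-inner w z dw dz wz
  ... | refl = walk-fromInner-endpoint c z y dz zy

  walk-sound : ∀ c {x y} → x ≢ y → T (walk c (branch x) (branch y)) → T (adj G x y)
  walk-sound zero {x} {y} _ p = branch-adjacent-branch x y p
  walk-sound (suc c) {x} {y} x≢y p with markedWalk-suc⁻ S isInner c (branch x) (branch y) p
  ... | z , z-inner , xz , zy with isInnerPoint⁻ (decode z) z-inner
  ... | e , _ , dz = endpoints-adjacent e
    (branch-adjacent-inner x z dz xz) (walk-fromInner-endpoint c z y dz zy) x≢y

  walk-along-edge : ∀ e c (t : Fin r) → suc c + toℕ t ≡ r →
    T (walk c (inner e t) (branch (proj₂ (ends e))))
  walk-along-edge e zero t last =
    linked⇒adjacent (inner e t) (branch _) (branch≢inner _ e t ∘ sym) (decode-inner e t) (decode-branch _)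
      (inj₂ (link-last e t last))
  walk-along-edge e (suc c) t remaining =
    markedWalk-suc⁺ S isInner c (inner e t) (branch (proj₂ (ends e))) (inner e t′) (isInner-inner e t′)
      step (walk-along-edge e c t′ remaining′)
    where
    t+1<r : suc (toℕ t) < r
    t+1<r = subst (suc (toℕ t) <_) remaining (s≤s (s≤s (m≤n+m (toℕ t) c)))
    t′ : Fin r
    t′ = fromℕ< t+1<r
    toℕ-t′ : toℕ t′ ≡ suc (toℕ t)
    toℕ-t′ = toℕ-fromℕ< t+1<r
    remaining′ : suc c + toℕ t′ ≡ r
    remaining′ rewrite toℕ-t′ = trans (+-suc (suc c) (toℕ t)) remaining
    step : T (adj S (inner e t) (inner e t′))
    step = linked⇒adjacent (inner e t) (inner e t′)
      (λ eq → 1+n≢n (sym (trans (cong toℕ (inner-injectiveʳ eq)) toℕ-t′)))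
      (decode-inner e t) (decode-inner e t′)
      (inj₁ (link-next e t t′ toℕ-t′))

edge-walk : ∀ G r e → let open Subdivided G r in
  T (walk r (branch (proj₁ (ends e))) (branch (proj₂ (ends e))))
edge-walk G zero e =
  linked⇒adjacent (branch x) (branch y) (ends-distinct e ∘ branch-injective) (decode-branch x) (decode-branch y)
    (inj₁ (ends-adjacent e))
  where
  open Subdivided G zero
  x = proj₁ (ends e)
  y = proj₂ (ends e)
edge-walk G (suc r) e =
  markedWalk-suc⁺ S isInner r (branch x) (branch (proj₂ (ends e))) (inner e Fin.zero) (isInner-inner e Fin.zero)
    first (walk-along-edge e r Fin.zero (cong suc (+-identityʳ r)))
  where
  open Subdivided G (suc r)
  x = proj₁ (ends e)
  first : T (adj S (branch x) (inner e Fin.zero))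
  first = linked⇒adjacent (branch x) (inner e Fin.zero) (branch≢inner x e Fin.zero)
    (decode-branch x) (decode-inner e Fin.zero)
    (inj₁ (link-first e Fin.zero refl))

branch-adjacency : ∀ G r {x y} → x ≢ y → let open Subdivided G r in
  adj G x y ≡ walk r (branch x) (branch y) ∨ walk r (branch y) (branch x)
branch-adjacency G r {x} {y} x≢y = T-injective complete sound
  where
  open Subdivided G r

  walk-between : ∀ {e a b} → ends e ≡ (a , b) → T (walk r (branch a) (branch b))
  walk-between {e} ends≡ =
    subst₂ (λ a b → T (walk r (branch a) (branch b))) (cong proj₁ ends≡) (cong proj₂ ends≡) (edge-walk G r e)

  complete : T (adj G x y) → T (walk r (branch x) (branch y) ∨ walk r (branch y) (branch x))
  complete xy with <-cmp x y
  ... | tri< x<y _ _ = from T-∨ (inj₁ (walk-between (proj₂ (edge-index x<y xy))))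
  ... | tri≈ _ x≡y _ = ⊥-elim (x≢y x≡y)
  ... | tri> _ _ y<x = from T-∨ (inj₂ (walk-between (proj₂ (edge-index y<x (subst T (adj-sym G x y) xy)))))

  sound : T (walk r (branch x) (branch y) ∨ walk r (branch y) (branch x)) → T (adj G x y)
  sound p with to T-∨ p
  ... | inj₁ q = walk-sound r x≢y q
  ... | inj₂ q = subst T (adj-sym G y x) (walk-sound r (x≢y ∘ sym) q)


symGraph-inducedSub : ∀ (H : Graph) n (R : Fin n → Fin n → Bool) (f : Fin (size H) → Fin n) →
  Injective _≡_ _≡_ f → (∀ x y → x ≢ y → adj H x y ≡ R (f x) (f y) ∨ R (f y) (f x)) →
  InducedSub H (symGraph n R)
symGraph-inducedSub H n R f f-inj adj≡ = f , f-inj , agrees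
  where
  agrees : ∀ x y → adj H x y ≡ not ⌊ f x ≟ f y ⌋ ∧ (R (f x) (f y) ∨ R (f y) (f x))
  agrees x y with f x ≟ f y
  ... | yes fx≡fy = subst (λ z → adj H x z ≡ false) (f-inj fx≡fy) (adj-irr H x)
  ... | no fx≢fy  = adj≡ x y (fx≢fy ∘ cong f)

branches-inducedSub : ∀ (H : Graph) r {k} (φ : Formula k 2) (Ĝ : ColoredGraph k) →
  (emb : InducedSub (subdivision r H) (interpret φ Ĝ)) →
  InducedSub H (interpret (markedWalkFormula φ r) (addColour Ĝ (image (proj₁ emb) (Subdivided.isInner H r))))
branches-inducedSub H r φ Ĝ (g , g-inj , g-adj) =
  symGraph-inducedSub H (size (graph Ĝ)) (λ u v → ψ (u ∷ v ∷ [])) (g ∘ branch) (branch-injective ∘ g-inj) agrees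
  where
  open Subdivided H r
  open ≡-Reasoning
  mark : Fin (size (graph Ĝ)) → Bool
  mark = image g isInner
  walkᴳ : Fin (size (graph Ĝ)) → Fin (size (graph Ĝ)) → Bool
  walkᴳ = markedWalk (interpret φ Ĝ) mark r
  ψ : (Fin 2 → Fin (size (graph Ĝ))) → Bool
  ψ = eval (addColour Ĝ mark) (markedWalkFormula φ r)

  agrees : ∀ x y → x ≢ y →
    adj H x y ≡ ψ (g (branch x) ∷ g (branch y) ∷ []) ∨ ψ (g (branch y) ∷ g (branch x) ∷ [])
  agrees x y x≢y = begin
    adj H x y
      ≡⟨ branch-adjacency H r x≢y ⟩
    walk r (branch x) (branch y) ∨ walk r (branch y) (branch x)
      ≡⟨ sym (cong₂ _∨_ (transfer (branch x) (branch y)) (transfer (branch y) (branch x))) ⟩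
    walkᴳ (g (branch x)) (g (branch y)) ∨ walkᴳ (g (branch y)) (g (branch x))
      ≡⟨ sym (cong₂ _∨_ (eval-markedWalkFormula φ Ĝ mark r _ _) (eval-markedWalkFormula φ Ĝ mark r _ _)) ⟩
    ψ (g (branch x) ∷ g (branch y) ∷ []) ∨ ψ (g (branch y) ∷ g (branch x) ∷ []) ∎
    where
    transfer : ∀ a b → walkᴳ (g a) (g b) ≡ walk r a b
    transfer = markedWalk-image S (interpret φ Ĝ) g g-adj isInner r

mainTheorem19 : (r : ℕ) (C : GraphClass) → Hereditary C →
    QFTransduces C (Subdivisions r) → ExTransduces C AllGraphs
mainTheorem19 r C _ (k , φ , φ-qf , Ĉ , Ĉ⊆C , covers) =
  suc k , markedWalkFormula φ r , markedWalkFormula-existential φ φ-qf r ,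
  C ∘ graph , (λ _ → id) , cover
  where
  cover : ∀ H → AllGraphs H →
    Σ (ColoredGraph (suc k)) λ Ĝ⁺ → C (graph Ĝ⁺) × InducedSub H (interpret (markedWalkFormula φ r) Ĝ⁺)
  cover H _ with covers (subdivision r H) (H , id , bijective _≡_ , λ _ _ → refl)
  ... | Ĝ , Ĝ∈Ĉ , emb =
    addColour Ĝ (image (proj₁ emb) (Subdivided.isInner H r)) , Ĉ⊆C Ĝ Ĝ∈Ĉ , branches-inducedSub H r φ Ĝ emb
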